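{- Let $M$ be a ring and $G,H$ directed graphs. There is an $M$-tension-continuous mapping from $G$ to $H$ if and only if there is a homomorphism $\Delta_M(G)\to\Delta_M(H)$.
   Context: $G,H$ are finite directed graphs with multiple edges and loops allowed. A ring is associative with unity. A circuit is a connected subgraph in which every vertex is incident with exactly two edge-ends; $C^+$/$C^-$ are its edges traversed forwards/backwards. An $M$-tension on $D$ is $\tau:E(D)\to M$ with $\sum_{C^+}\tau=\sum_{C^- }\tau$ for every circuit $C$; $f:E(D)\to E(D')$ is $M$-tension-continuous if $\tau\circ f$ is an $M$-tension for every $M$-tension $\tau$ on $D'$. For a graph $H$ and $v\in V(H)$, $e_v:V(H)\to M$ is the indicator function of $v$. The free Cayley graph $\Delta_M(H)$ has vertex set $M^{V(H)}$ and an edge $(f,g)$ whenever $g-f=e_v-e_u$ for some edge $(u,v)\in E(H)$. -}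

module Defs where

open import Level using (Level; _⊔_)
open import Data.Nat using (ℕ)
open import Data.Fin using (Fin; _≟_)
open import Data.Bool using (Bool; true; false)
open import Data.List using (List; []; _∷_; map)
open import Data.List.Relation.Unary.Unique.Propositional using (Unique)
open import Data.Product using (Σ; _×_; _,_; proj₁; ∃)
open import Relation.Binary.PropositionalEquality using (_≡_)
open import Relation.Nullary using (¬_; yes; no)
open import Algebra.Bundles using (Ring)

record Digraph : Set where
  field
    nV  : ℕ
    nE  : ℕ
    src : Fin nE → Fin nV
    tgt : Fin nE → Fin nV
open Digraph public

V : Digraph → Set
V D = Fin (nV D)

E : Digraph → Set
E D = Fin (nE D)

-- A step of a walk: an edge together with its traversal direction
-- (true = forwards, from src to tgt; false = backwards).
Step : Digraph → Set
Step D = E D × Bool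

stepFrom : (D : Digraph) → Step D → V D
stepFrom D (e , true)  = src D e
stepFrom D (e , false) = tgt D e

stepTo : (D : Digraph) → Step D → V D
stepTo D (e , true)  = tgt D e
stepTo D (e , false) = src D e

IsWalk : (D : Digraph) → V D → List (Step D) → V D → Set
IsWalk D v []       w = v ≡ w
IsWalk D v (st ∷ s) w = (stepFrom D st ≡ v) × IsWalk D (stepTo D st) s w

-- A circuit (connected subgraph, every vertex incident with exactly two
-- edge-ends), presented as a closed walk starting at v that uses at least
-- one edge, with pairwise distinct edges and pairwise distinct visited
-- vertices. The orientation of traversal determines C⁺ / C⁻.
record Circuit (D : Digraph) : Set where
  field
    start : V D
    steps : List (Step D)
    nonempty : ¬ (steps ≡ [])
    closed : IsWalk D start steps start
    distinctEdges : Unique (map proj₁ steps)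
    distinctVertices : Unique (map (stepFrom D) steps)
open Circuit public

module _ {c ℓ : Level} (M : Ring c ℓ) where
  open Ring M

  sumFwd : (D : Digraph) → (E D → Carrier) → List (Step D) → Carrier
  sumFwd D τ []                = 0#
  sumFwd D τ ((e , true) ∷ s)  = τ e + sumFwd D τ s
  sumFwd D τ ((e , false) ∷ s) = sumFwd D τ s

  sumBwd : (D : Digraph) → (E D → Carrier) → List (Step D) → Carrier
  sumBwd D τ []                = 0#
  sumBwd D τ ((e , true) ∷ s)  = sumBwd D τ s
  sumBwd D τ ((e , false) ∷ s) = τ e + sumBwd D τ s

  IsTension : (D : Digraph) → (E D → Carrier) → Set ℓ
  IsTension D τ = (C : Circuit D) → sumFwd D τ (steps C) ≈ sumBwd D τ (steps C)

  TensionContinuous : (D D' : Digraph) → (E D → E D') → Set (c ⊔ ℓ)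
  TensionContinuous D D' f =
    (τ : E D' → Carrier) → IsTension D' τ → IsTension D (λ x → τ (f x))

  indicator : (H : Digraph) → V H → V H → Carrier
  indicator H v x with x ≟ v
  ... | yes _ = 1#
  ... | no  _ = 0#

  ΔVertex : Digraph → Set c
  ΔVertex H = V H → Carrier

  _≈Δ_ : {H : Digraph} → ΔVertex H → ΔVertex H → Set ℓ
  f ≈Δ g = ∀ x → f x ≈ g x

  ΔEdge : (H : Digraph) → ΔVertex H → ΔVertex H → Set ℓ
  ΔEdge H f g = Σ (E H) λ e → ∀ x →
    g x - f x ≈ indicator H (tgt H e) x - indicator H (src H e) x

  record ΔHom (G H : Digraph) : Set (c ⊔ ℓ) where
    field
      map₀ : ΔVertex G → ΔVertex H
      cong₀ : ∀ {f g} → _≈Δ_ {G} f g → _≈Δ_ {H} (map₀ f) (map₀ g)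
      edges : ∀ f g → ΔEdge G f g → ΔEdge H (map₀ f) (map₀ g)

module Submission where

-- Over any ring, M-tensions are exactly the coboundaries δp of potentials p:
-- adding the edges one at a time, an edge inside a component is forced by the
-- circuit it closes, and an edge joining two components is fitted by shifting
-- the potential on one of them. Given a tension-continuous f, let q_w be a
-- potential of the pullback along f of δe_w; then x ↦ (w ↦ Σ_v x_v q_w(v))
-- maps Δ-edges to Δ-edges. Conversely a homomorphism φ sends the edge
-- (e_{src e}, e_{tgt e}) to an edge of some label f(e), and a tension δp on H
-- pulls back along f to δQ with Q(v) = Σ_w φ(e_v)_w p(w).

open import Defs
open import Level using (Level; _⊔_)
open import Function.Base using (_∘_)
open import Function.Bundles using (_⇔_; mk⇔)
open import Algebra.Bundles using (Ring)
open import Data.Nat.Base using (ℕ; zero; suc)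
open import Data.Fin.Base using (Fin; zero; suc; punchIn)
open import Data.Fin.Properties using (_≟_; suc-injective; punchInᵢ≢i)
open import Data.Bool.Base using (true; false)
open import Data.Product.Base using (Σ; ∃; _×_; _,_; proj₁; proj₂)
open import Data.Sum.Base using (_⊎_; inj₁; inj₂; [_,_]′)
open import Data.Empty using (⊥)
open import Data.List.Base using (List; []; _∷_; map; _++_)
open import Data.List.Relation.Unary.All using (All; []; _∷_)
open import Data.List.Relation.Unary.All.Properties using (¬Any⇒All¬)
open import Data.List.Relation.Unary.Any using (here; there)
open import Data.List.Membership.Propositional using (_∈_; _∉_)
open import Data.List.Membership.Propositional.Properties using (∈-map⁻)
import Data.List.Membership.DecPropositional as DecMembership
open import Data.List.Relation.Unary.Unique.Propositional using (Unique; []; _∷_)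
import Data.List.Relation.Unary.Unique.Propositional.Properties as Unique
open import Relation.Binary.PropositionalEquality
  using (_≡_; _≢_; refl; sym; trans; cong; subst)
open import Relation.Nullary.Decidable.Core using (Dec; yes; no)
open import Relation.Nullary.Negation.Core using (contradiction)

mkDigraph : (n m : ℕ) → (Fin m → Fin n) → (Fin m → Fin n) → Digraph
mkDigraph n m s t = record { nV = n ; nE = m ; src = s ; tgt = t }

Walk : (D : Digraph) → V D → V D → Set
Walk D a b = ∃ λ w → IsWalk D a w b

IsWalk-++ : ∀ D {a b c} (w w′ : List (Step D)) →
  IsWalk D a w b → IsWalk D b w′ c → IsWalk D a (w ++ w′) c
IsWalk-++ D []       w′ refl          walk′ = walk′
IsWalk-++ D (_ ∷ w)  w′ (from , walk) walk′ = from , IsWalk-++ D w w′ walk walk′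

walk-++ : ∀ {D a b c} → Walk D a b → Walk D b c → Walk D a c
walk-++ {D} (w , walk) (w′ , walk′) = w ++ w′ , IsWalk-++ D w w′ walk walk′

-- The end vertex is listed first: closing a path from x to u by an edge u → x
-- then gives exactly the vertex list of the resulting circuit.
pathVertices : (D : Digraph) → V D → List (Step D) → List (V D)
pathVertices D b P = b ∷ map (stepFrom D) P

record IsPath (D : Digraph) (a : V D) (P : List (Step D)) (b : V D) : Set where
  constructor isPath
  field
    walk             : IsWalk D a P b
    distinctVertices : Unique (pathVertices D b P)
    distinctEdges    : Unique (map proj₁ P)

Path : (D : Digraph) → V D → V D → Set
Path D a b = ∃ λ P → IsPath D a P b

trivialPath : ∀ {D a b} → a ≡ b → Path D a b
trivialPath a≡b = [] , isPath a≡b ([] ∷ []) []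

∈-skip : ∀ {A : Set} {x y z : A} {zs} → x ∈ y ∷ zs → x ∈ y ∷ z ∷ zs
∈-skip (here x≡y) = here x≡y
∈-skip (there x∈) = there (there x∈)

Unique-insertSecond : ∀ {A : Set} {x y : A} {zs} →
  x ∉ y ∷ zs → Unique (y ∷ zs) → Unique (y ∷ x ∷ zs)
Unique-insertSecond {zs = zs} x∉ (y≢ ∷ unique) =
  ((λ y≡x → x∉ (here (sym y≡x))) ∷ y≢) ∷ (¬Any⇒All¬ zs (x∉ ∘ there) ∷ unique)

module _ (D : Digraph) where

  start∈pathVertices : ∀ {a b} P → IsWalk D a P b → a ∈ pathVertices D b P
  start∈pathVertices []      a≡b        = here a≡b
  start∈pathVertices (_ ∷ _) (from , _) = there (here (sym from))

  endpoints∈pathVertices : ∀ {a b} P → IsWalk D a P b → ∀ {st} → st ∈ P →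
    stepFrom D st ∈ pathVertices D b P × stepTo D st ∈ pathVertices D b P
  endpoints∈pathVertices (_ ∷ P) (_ , walk) (here refl) =
    there (here refl) , ∈-skip (start∈pathVertices P walk)
  endpoints∈pathVertices (_ ∷ P) (_ , walk) (there st∈P) =
    let from∈ , to∈ = endpoints∈pathVertices P walk st∈P in ∈-skip from∈ , ∈-skip to∈

  stepFrom-endpoint : ∀ (st st′ : Step D) → proj₁ st ≡ proj₁ st′ →
    stepFrom D st ≡ stepFrom D st′ ⊎ stepFrom D st ≡ stepTo D st′
  stepFrom-endpoint (e , true)  (.e , true)  refl = inj₁ refl
  stepFrom-endpoint (e , true)  (.e , false) refl = inj₂ refl
  stepFrom-endpoint (e , false) (.e , true)  refl = inj₂ refl
  stepFrom-endpoint (e , false) (.e , false) refl = inj₁ refl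

  path-suffix : ∀ {a b x} P → IsPath D a P b → x ∈ pathVertices D b P → Path D x b
  path-suffix _        _ (here refl) = trivialPath refl
  path-suffix (st ∷ P) (isPath (_ , walk) vs es) (there (here refl)) =
    st ∷ P , isPath (refl , walk) vs es
  path-suffix (st ∷ P) (isPath (_ , walk) ((_ ∷ b≢) ∷ (_ ∷ vs)) (_ ∷ es)) (there (there x∈)) =
    path-suffix P (isPath walk (b≢ ∷ vs) es) (there x∈)

  -- If the new start vertex already lies on the path built for the tail,
  -- cut the path there instead of prepending the step.
  walk⇒path : ∀ {a b} → Walk D a b → Path D a b
  walk⇒path ([] , a≡b) = trivialPath a≡b
  walk⇒path {a} {b} (st ∷ w , from , walk) with walk⇒path (w , walk)
  ... | P , path with DecMembership._∈?_ _≟_ a (pathVertices D b P)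
  ...   | yes a∈ = path-suffix P path a∈
  ...   | no  a∉ =
    st ∷ P , isPath (from , walk′) vertices (¬Any⇒All¬ (map proj₁ P) newEdge ∷ edges)
    where
    open IsPath path renaming (walk to walk′; distinctVertices to vertices′; distinctEdges to edges)
    vertices : Unique (pathVertices D b (st ∷ P))
    vertices = subst (λ x → Unique (b ∷ x ∷ map (stepFrom D) P)) (sym from)
                     (Unique-insertSecond a∉ vertices′)
    newEdge : proj₁ st ∉ map proj₁ P
    newEdge e∈ =
      let st′ , st′∈P , same = ∈-map⁻ proj₁ e∈
          from∈ , to∈       = endpoints∈pathVertices P walk′ st′∈P
      in [ onPath from∈ , onPath to∈ ]′ (stepFrom-endpoint st st′ same)
      where
      onPath : ∀ {x} → x ∈ pathVertices D b P → stepFrom D st ≡ x → ⊥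
      onPath x∈ eq = a∉ (subst (_∈ pathVertices D b P) (trans (sym eq) from) x∈)

-- Labels are vertices only so that they can be compared decidably.
record Components (D : Digraph) : Set where
  field
    label      : V D → V D
    label-edge : ∀ e → label (src D e) ≡ label (tgt D e)
    connect    : ∀ x y → label x ≡ label y → Walk D x y

redirect : ∀ {n} → Fin n → Fin n → Fin n → Fin n
redirect from to l with l ≟ from
... | yes _ = to
... | no  _ = l

redirect-hit : ∀ {n} {from to l : Fin n} → l ≡ from → redirect from to l ≡ to
redirect-hit {from = from} {l = l} l≡from with l ≟ from
... | yes _    = refl
... | no  l≢from = contradiction l≡from l≢from

redirect-miss : ∀ {n} {from to l : Fin n} → l ≢ from → redirect from to l ≡ l
redirect-miss {from = from} {l = l} l≢from with l ≟ from
... | yes l≡from = contradiction l≡from l≢from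
... | no  _      = refl

module FirstEdge {n m : ℕ} (s t : Fin (suc m) → Fin n) where

  D D⁻ : Digraph
  D  = mkDigraph n (suc m) s t
  D⁻ = mkDigraph n m (s ∘ suc) (t ∘ suc)

  u v : Fin n
  u = s zero
  v = t zero

  liftStep : Step D⁻ → Step D
  liftStep (e , d) = suc e , d

  IsWalk-lift : ∀ {a b} w → IsWalk D⁻ a w b → IsWalk D a (map liftStep w) b
  IsWalk-lift []               a≡b           = a≡b
  IsWalk-lift ((_ , true)  ∷ w) (from , walk) = from , IsWalk-lift w walk
  IsWalk-lift ((_ , false) ∷ w) (from , walk) = from , IsWalk-lift w walk

  liftWalk : ∀ {a b} → Walk D⁻ a b → Walk D a b
  liftWalk (w , walk) = map liftStep w , IsWalk-lift w walk

  edges-lift : ∀ w → map proj₁ (map liftStep w) ≡ map suc (map proj₁ w)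
  edges-lift []      = refl
  edges-lift (_ ∷ w) = cong (_ ∷_) (edges-lift w)

  vertices-lift : ∀ w → map (stepFrom D) (map liftStep w) ≡ map (stepFrom D⁻) w
  vertices-lift []               = refl
  vertices-lift ((_ , true)  ∷ w) = cong (_ ∷_) (vertices-lift w)
  vertices-lift ((_ , false) ∷ w) = cong (_ ∷_) (vertices-lift w)

  Unique-edges-lift : ∀ w → Unique (map proj₁ w) → Unique (map proj₁ (map liftStep w))
  Unique-edges-lift w unique =
    subst Unique (sym (edges-lift w)) (Unique.map⁺ suc-injective unique)

  liftCircuit : Circuit D⁻ → Circuit D
  liftCircuit C = record
    { start            = start C
    ; steps            = map liftStep (steps C)
    ; nonempty         = nonempty C ∘ map-≡[] (steps C)
    ; closed           = IsWalk-lift (steps C) (closed C)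
    ; distinctEdges    = Unique-edges-lift (steps C) (distinctEdges C)
    ; distinctVertices = subst Unique (sym (vertices-lift (steps C))) (distinctVertices C)
    }
    where
    map-≡[] : ∀ w → map liftStep w ≡ [] → w ≡ []
    map-≡[] [] _ = refl

  closePath : ∀ {P} → IsPath D⁻ v P u → Circuit D
  closePath {P} (isPath walk vertices edges) = record
    { start            = u
    ; steps            = (zero , true) ∷ map liftStep P
    ; nonempty         = λ ()
    ; closed           = refl , IsWalk-lift P walk
    ; distinctEdges    = zero∉ P ∷ Unique-edges-lift P edges
    ; distinctVertices = subst (Unique ∘ (u ∷_)) (sym (vertices-lift P)) vertices
    }
    where
    zero∉ : ∀ w → All (zero ≢_) (map proj₁ (map liftStep w))
    zero∉ []      = []
    zero∉ (_ ∷ w) = (λ ()) ∷ zero∉ w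

  forwardEdge : Walk D u v
  forwardEdge = (zero , true) ∷ [] , refl , refl

  backwardEdge : Walk D v u
  backwardEdge = (zero , false) ∷ [] , refl , refl

  addEdge : Components D⁻ → Components D
  addEdge C = join (label u ≟ label v)
    where
    open Components C
    join : Dec (label u ≡ label v) → Components D
    join (yes same) = record
      { label      = label
      ; label-edge = λ { zero → same ; (suc e) → label-edge e }
      ; connect    = λ x y eq → liftWalk (connect x y eq)
      }
    join (no different) = record
      { label      = label′
      ; label-edge = λ { zero → edge₀ ; (suc e) → cong (redirect (label v) (label u)) (label-edge e) }
      ; connect    = λ x y eq → connect′ x y eq (label x ≟ label v) (label y ≟ label v)
      }
      where
      label′ : Fin n → Fin n
      label′ = redirect (label v) (label u) ∘ label
      edge₀ : label′ u ≡ label′ v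
      edge₀ = trans (redirect-miss different) (sym (redirect-hit {l = label v} refl))
      connect′ : ∀ x y → label′ x ≡ label′ y →
        Dec (label x ≡ label v) → Dec (label y ≡ label v) → Walk D x y
      connect′ x y eq (yes x~v) (yes y~v) = liftWalk (connect x y (trans x~v (sym y~v)))
      connect′ x y eq (yes x~v) (no  y≁v) =
        walk-++ (liftWalk (connect x v x~v)) (walk-++ backwardEdge (liftWalk (connect u y
          (trans (sym (redirect-hit x~v)) (trans eq (redirect-miss y≁v))))))
      connect′ x y eq (no  x≁v) (yes y~v) =
        walk-++ (liftWalk (connect x u (trans (sym (redirect-miss x≁v)) (trans eq (redirect-hit y~v)))))
          (walk-++ forwardEdge (liftWalk (connect v y (sym y~v))))
      connect′ x y eq (no  x≁v) (no  y≁v) =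
        liftWalk (connect x y (trans (sym (redirect-miss x≁v)) (trans eq (redirect-miss y≁v))))

components : ∀ n m (s t : Fin m → Fin n) → Components (mkDigraph n m s t)
components n zero    s t = record { label = λ x → x ; label-edge = λ () ; connect = λ _ _ eq → [] , eq }
components n (suc m) s t = FirstEdge.addEdge s t (components n m (s ∘ suc) (t ∘ suc))

module _ {c ℓ : Level} (M : Ring c ℓ) where

  open Ring M renaming (refl to ≈-refl; sym to ≈-sym; trans to ≈-trans) hiding (zero)
  open import Algebra.Properties.Ring M
    using (x≈z//y; //-rightDividesˡ; +-cancelʳ; -0#≈0#; -‿+-comm; [y-z]x≈yx-zx)
  open import Algebra.Properties.Semiring.Sum semiring
    using (sum; sum-cong-≋; sum-remove; sum-replicate-zero; ∑-distrib-+)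
  open import Algebra.Properties.CommutativeSemigroup +-commutativeSemigroup
    using (xy∙z≈y∙xz; x∙yz≈y∙xz; xy∙z≈xz∙y)
  open import Relation.Binary.Reasoning.Setoid setoid hiding (start)

  coboundary : (D : Digraph) → (V D → Carrier) → E D → Carrier
  coboundary D p e = p (tgt D e) - p (src D e)

  IsPotential : (D : Digraph) → (E D → Carrier) → (V D → Carrier) → Set ℓ
  IsPotential D τ p = ∀ e → τ e ≈ coboundary D p e

  Potential : (D : Digraph) → (E D → Carrier) → Set (c ⊔ ℓ)
  Potential D τ = Σ (V D → Carrier) (IsPotential D τ)

  potential-step : ∀ D {τ} p → IsPotential D τ p → ∀ e → τ e + p (src D e) ≈ p (tgt D e)
  potential-step D {τ} p potential e =
    ≈-trans (+-congʳ (potential e)) (//-rightDividesˡ (p (src D e)) (p (tgt D e)))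

  potential-fromSteps : ∀ D {τ} p → (∀ e → τ e + p (src D e) ≈ p (tgt D e)) → IsPotential D τ p
  potential-fromSteps D {τ} p step e = x≈z//y (τ e) (p (src D e)) (p (tgt D e)) (step e)

  potential-walk : ∀ D {τ} p → IsPotential D τ p → ∀ {a b} w → IsWalk D a w b →
    sumFwd M D τ w + p a ≈ sumBwd M D τ w + p b
  potential-walk D p potential [] refl = ≈-refl
  potential-walk D {τ} p potential ((e , true) ∷ w) (refl , walk) = begin
    (τ e + sumFwd M D τ w) + p (src D e) ≈⟨ xy∙z≈y∙xz _ _ _ ⟩
    sumFwd M D τ w + (τ e + p (src D e)) ≈⟨ +-congˡ (potential-step D p potential e) ⟩
    sumFwd M D τ w + p (tgt D e)         ≈⟨ potential-walk D p potential w walk ⟩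
    sumBwd M D τ w + _                   ∎
  potential-walk D {τ} p potential ((e , false) ∷ w) (refl , walk) = begin
    sumFwd M D τ w + p (tgt D e)         ≈⟨ +-congˡ (potential-step D p potential e) ⟨
    sumFwd M D τ w + (τ e + p (src D e)) ≈⟨ x∙yz≈y∙xz _ _ _ ⟩
    τ e + (sumFwd M D τ w + p (src D e)) ≈⟨ +-congˡ (potential-walk D p potential w walk) ⟩
    τ e + (sumBwd M D τ w + _)           ≈⟨ +-assoc _ _ _ ⟨
    (τ e + sumBwd M D τ w) + _           ∎

  potential⇒tension : ∀ D {τ} p → IsPotential D τ p → IsTension M D τ
  potential⇒tension D p potential C =
    +-cancelʳ (p (start C)) _ _ (potential-walk D p potential (steps C) (closed C))

  coboundary-isTension : ∀ D p → IsTension M D (coboundary D p)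
  coboundary-isTension D p = potential⇒tension D p (λ _ → ≈-refl)

  indicator-self-* : ∀ H (v : V H) k → indicator M H v v * k ≈ k
  indicator-self-* H v k with v ≟ v
  ... | yes _   = *-identityˡ k
  ... | no  v≢v = contradiction refl v≢v

  indicator-other-* : ∀ H {v x : V H} k → x ≢ v → indicator M H v x * k ≈ 0#
  indicator-other-* H {v} {x} k x≢v with x ≟ v
  ... | yes x≡v = contradiction x≡v x≢v
  ... | no  _   = zeroˡ k

  module _ {n m : ℕ} (s t : Fin (suc m) → Fin n) where
    open FirstEdge s t

    sumFwd-lift : ∀ τ w → sumFwd M D τ (map liftStep w) ≡ sumFwd M D⁻ (τ ∘ suc) w
    sumFwd-lift τ []               = refl
    sumFwd-lift τ ((e , true)  ∷ w) = cong (τ (suc e) +_) (sumFwd-lift τ w)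
    sumFwd-lift τ ((e , false) ∷ w) = sumFwd-lift τ w

    sumBwd-lift : ∀ τ w → sumBwd M D τ (map liftStep w) ≡ sumBwd M D⁻ (τ ∘ suc) w
    sumBwd-lift τ []               = refl
    sumBwd-lift τ ((e , true)  ∷ w) = sumBwd-lift τ w
    sumBwd-lift τ ((e , false) ∷ w) = cong (τ (suc e) +_) (sumBwd-lift τ w)

    IsTension-delete : ∀ {τ} → IsTension M D τ → IsTension M D⁻ (τ ∘ suc)
    IsTension-delete {τ} tension C = begin
      sumFwd M D⁻ (τ ∘ suc) (steps C)           ≡⟨ sumFwd-lift τ (steps C) ⟨
      sumFwd M D τ (map liftStep (steps C))     ≈⟨ tension (liftCircuit C) ⟩
      sumBwd M D τ (map liftStep (steps C))     ≡⟨ sumBwd-lift τ (steps C) ⟩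
      sumBwd M D⁻ (τ ∘ suc) (steps C)           ∎

    -- The path closes the new edge to a circuit, on which τ balances; the
    -- potential balances along the path itself.
    potential-addChord : ∀ {τ} → IsTension M D τ → Path D⁻ v u →
      Potential D⁻ (τ ∘ suc) → Potential D τ
    potential-addChord {τ} tension (P , path) (p , potential) =
      p , λ { zero → chord ; (suc e) → potential e }
      where
      F B : Carrier
      F = sumFwd M D⁻ (τ ∘ suc) P
      B = sumBwd M D⁻ (τ ∘ suc) P
      circuit : τ zero + F ≈ B
      circuit = begin
        τ zero + F                             ≡⟨ cong (τ zero +_) (sumFwd-lift τ P) ⟨
        sumFwd M D τ (steps (closePath path))  ≈⟨ tension (closePath path) ⟩
        sumBwd M D τ (steps (closePath path))  ≡⟨ sumBwd-lift τ P ⟩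
        B                                      ∎
      chord : τ zero ≈ p v - p u
      chord = x≈z//y (τ zero) (p u) (p v) (+-cancelʳ F _ _ (begin
        (τ zero + p u) + F ≈⟨ xy∙z≈xz∙y _ _ _ ⟩
        (τ zero + F) + p u ≈⟨ +-congʳ circuit ⟩
        B + p u            ≈⟨ potential-walk D⁻ p potential P (IsPath.walk path) ⟨
        F + p v            ≈⟨ +-comm F (p v) ⟩
        p v + F            ∎))

    -- Shift the potential on the component of v so that the new edge fits.
    potential-addBridge : ∀ {τ} (C : Components D⁻) →
      Components.label C u ≢ Components.label C v →
      Potential D⁻ (τ ∘ suc) → Potential D τ
    potential-addBridge {τ} C different (p , potential) = p′ , potential-fromSteps D p′ step
      where
      open Components C
      k : Carrier
      k = (τ zero + p u) - p v
      shift : Fin n → Carrier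
      shift x = indicator M D⁻ (label v) (label x) * k
      p′ : Fin n → Carrier
      p′ x = p x + shift x
      step : ∀ e → τ e + p′ (s e) ≈ p′ (t e)
      step zero = begin
        τ zero + (p u + shift u) ≈⟨ +-congˡ (+-congˡ (indicator-other-* D⁻ k different)) ⟩
        τ zero + (p u + 0#)      ≈⟨ +-congˡ (+-identityʳ (p u)) ⟩
        τ zero + p u             ≈⟨ //-rightDividesˡ (p v) (τ zero + p u) ⟨
        k + p v                  ≈⟨ +-comm k (p v) ⟩
        p v + k                  ≈⟨ +-congˡ (indicator-self-* D⁻ (label v) k) ⟨
        p v + shift v            ∎
      step (suc e) = begin
        τ (suc e) + (p (s (suc e)) + shift (s (suc e))) ≈⟨ +-assoc _ _ _ ⟨
        (τ (suc e) + p (s (suc e))) + shift (s (suc e)) ≈⟨ +-congʳ (potential-step D⁻ p potential e) ⟩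
        p (t (suc e)) + shift (s (suc e))
          ≡⟨ cong (λ l → p (t (suc e)) + indicator M D⁻ (label v) l * k) (label-edge e) ⟩
        p (t (suc e)) + shift (t (suc e))               ∎

  tension⇒potential : ∀ n m (s t : Fin m → Fin n) τ →
    IsTension M (mkDigraph n m s t) τ → Potential (mkDigraph n m s t) τ
  tension⇒potential n zero    s t τ tension = (λ _ → 0#) , λ ()
  tension⇒potential n (suc m) s t τ tension = join (label u ≟ label v)
    where
    open FirstEdge s t
    C : Components D⁻
    C = components n m (s ∘ suc) (t ∘ suc)
    open Components C
    deleted : Potential D⁻ (τ ∘ suc)
    deleted = tension⇒potential n m (s ∘ suc) (t ∘ suc) (τ ∘ suc) (IsTension-delete s t tension)
    join : Dec (label u ≡ label v) → Potential D τ
    join (yes same)      = potential-addChord s t tension (walk⇒path D⁻ (connect v u (sym same))) deleted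
    join (no  different) = potential-addBridge s t C different deleted

  potentialOf : ∀ D {τ} → IsTension M D τ → Potential D τ
  potentialOf D {τ} = tension⇒potential (nV D) (nE D) (src D) (tgt D) τ

  sum-negate : ∀ {n} (g : Fin n → Carrier) → sum (λ i → - g i) ≈ - sum g
  sum-negate {zero}  g = ≈-sym -0#≈0#
  sum-negate {suc n} g = ≈-trans (+-congˡ (sum-negate (g ∘ suc))) (-‿+-comm (g zero) (sum (g ∘ suc)))

  sum-eq-single : ∀ {n} (i : Fin n) (g : Fin n → Carrier) →
    (∀ j → j ≢ i → g j ≈ 0#) → sum g ≈ g i
  sum-eq-single {suc n} i g vanish = begin
    sum g                           ≈⟨ sum-remove {i = i} g ⟩
    g i + sum (g ∘ punchIn i)       ≈⟨ +-congˡ (sum-cong-≋ {n} (λ j → vanish _ (punchInᵢ≢i i j))) ⟩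
    g i + sum {n} (λ _ → 0#)        ≈⟨ +-congˡ (sum-replicate-zero n) ⟩
    g i + 0#                        ≈⟨ +-identityʳ (g i) ⟩
    g i                             ∎

  ⟪_∣_⟫ : ∀ {n} → (Fin n → Carrier) → (Fin n → Carrier) → Carrier
  ⟪ x ∣ q ⟫ = sum (λ i → x i * q i)

  ⟪⟫-congˡ : ∀ {n} {x y : Fin n → Carrier} q → (∀ i → x i ≈ y i) → ⟪ x ∣ q ⟫ ≈ ⟪ y ∣ q ⟫
  ⟪⟫-congˡ q x≈y = sum-cong-≋ (λ i → *-congʳ (x≈y i))

  ⟪⟫-distrib-‿ : ∀ {n} (x y q : Fin n → Carrier) →
    ⟪ x ∣ q ⟫ - ⟪ y ∣ q ⟫ ≈ ⟪ (λ i → x i - y i) ∣ q ⟫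
  ⟪⟫-distrib-‿ x y q = begin
    ⟪ x ∣ q ⟫ - ⟪ y ∣ q ⟫                          ≈⟨ +-congˡ (sum-negate (λ i → y i * q i)) ⟨
    ⟪ x ∣ q ⟫ + sum (λ i → - (y i * q i))          ≈⟨ ∑-distrib-+ (λ i → x i * q i) _ ⟨
    sum (λ i → x i * q i - y i * q i)              ≈⟨ sum-cong-≋ (λ i → [y-z]x≈yx-zx (q i) (x i) (y i)) ⟨
    ⟪ (λ i → x i - y i) ∣ q ⟫                      ∎

  ⟪indicator∣⟫ : ∀ H (v : V H) q → ⟪ indicator M H v ∣ q ⟫ ≈ q v
  ⟪indicator∣⟫ H v q = begin
    ⟪ indicator M H v ∣ q ⟫  ≈⟨ sum-eq-single v _ (λ x → indicator-other-* H (q x)) ⟩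
    indicator M H v v * q v  ≈⟨ indicator-self-* H v (q v) ⟩
    q v                      ∎

  ⟪⟫-edge : ∀ H {a b : V H} {x y : V H → Carrier} q →
    (∀ i → y i - x i ≈ indicator M H b i - indicator M H a i) →
    ⟪ y ∣ q ⟫ - ⟪ x ∣ q ⟫ ≈ q b - q a
  ⟪⟫-edge H {a} {b} {x} {y} q edge = begin
    ⟪ y ∣ q ⟫ - ⟪ x ∣ q ⟫                                   ≈⟨ ⟪⟫-distrib-‿ y x q ⟩
    ⟪ (λ i → y i - x i) ∣ q ⟫                               ≈⟨ ⟪⟫-congˡ q edge ⟩
    ⟪ (λ i → indicator M H b i - indicator M H a i) ∣ q ⟫   ≈⟨ ⟪⟫-distrib-‿ _ _ q ⟨
    ⟪ indicator M H b ∣ q ⟫ - ⟪ indicator M H a ∣ q ⟫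
      ≈⟨ +-cong (⟪indicator∣⟫ H b q) (-‿cong (⟪indicator∣⟫ H a q)) ⟩
    q b - q a                                               ∎

  tensionContinuous⇒ΔHom : ∀ G H → Σ (E G → E H) (TensionContinuous M G H) → ΔHom M G H
  tensionContinuous⇒ΔHom G H (f , continuous) = record
    { map₀  = λ x w → ⟪ x ∣ q w ⟫
    ; cong₀ = λ x≈y w → ⟪⟫-congˡ (q w) x≈y
    ; edges = λ x y (e , edge) → f e , λ w → begin
        ⟪ y ∣ q w ⟫ - ⟪ x ∣ q w ⟫         ≈⟨ ⟪⟫-edge G (q w) edge ⟩
        q w (tgt G e) - q w (src G e)      ≈⟨ potential w e ⟨
        coboundary H (coordinate w) (f e)        ∎
    }
    where
    coordinate : V H → V H → Carrier
    coordinate w v = indicator M H v w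
    q : V H → V G → Carrier
    q w = proj₁ (potentialOf G (continuous _ (coboundary-isTension H (coordinate w))))
    potential : ∀ w → IsPotential G (coboundary H (coordinate w) ∘ f) (q w)
    potential w = proj₂ (potentialOf G (continuous _ (coboundary-isTension H (coordinate w))))

  ΔHom⇒tensionContinuous : ∀ G H → ΔHom M G H → Σ (E G → E H) (TensionContinuous M G H)
  ΔHom⇒tensionContinuous G H φ = f , continuous
    where
    open ΔHom φ
    image : ∀ e → ΔEdge M H (map₀ (indicator M G (src G e))) (map₀ (indicator M G (tgt G e)))
    image e = edges _ _ (e , λ _ → ≈-refl)
    f : E G → E H
    f e = proj₁ (image e)
    continuous : TensionContinuous M G H f
    continuous τ tension = potential⇒tension G Q λ e → begin
      τ (f e)                                   ≈⟨ potential (f e) ⟩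
      p (tgt H (f e)) - p (src H (f e))         ≈⟨ ⟪⟫-edge H p (proj₂ (image e)) ⟨
      Q (tgt G e) - Q (src G e)                 ∎
      where
      p : V H → Carrier
      p = proj₁ (potentialOf H tension)
      potential : IsPotential H τ p
      potential = proj₂ (potentialOf H tension)
      Q : V G → Carrier
      Q v = ⟪ map₀ (indicator M G v) ∣ p ⟫

corollary34 : {c ℓ : Level} (M : Ring c ℓ) (G H : Digraph) →
    (Σ (E G → E H) (TensionContinuous M G H)) ⇔ ΔHom M G H
corollary34 M G H = mk⇔ (tensionContinuous⇒ΔHom M G H) (ΔHom⇒tensionContinuous M G H)
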